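{- Let $\varepsilon\colon X^{\times}_{\mathrm{irr}}\to\mathcal{P}(M)$ be a Fitch map and let $(T,\lambda)$ be an edge-labeled tree on $X$ with $M$ that explains $\varepsilon$. Then for every leaf $y\in X$ and every color $m\in M$ there is a vertex $v\in V(T)$ satisfying the following two statements, which are equivalent (for any vertex $v$ of $T$, (1) holds if and only if (2) holds): (1) (a) there is no $m$-edge on the path from $v$ to $y$, and (b) the edge $(\mathrm{par}(v),v)$ is an $m$-edge unless $v$ is the root of $T$; (2) $N_m[y]=C_T(v)$.
   Context: $X$ is a finite nonempty set, $M$ a finite nonempty set of colors, $X^{\times}_{\mathrm{irr}}=\{(x,y)\in X\times X: x\neq y\}$, and $\mathcal{P}(M)$ the power set of $M$. A phylogenetic tree on $X$ is a rooted tree $T$ whose leaves (non-root vertices of degree $1$) form the set $X$, whose root has degree $\ge 2$ and whose non-root inner vertices have degree $\ge 3$. For vertices $v,w$ write $v\preceq w$ if $v$ lies on the path from the root to $w$; $\mathrm{lca}(x,y)$ is the $\preceq$-maximal vertex that is an ancestor of both $x$ and $y$. Edges are written $(\mathrm{par}(v),v)$ with $\mathrm{par}(v)$ the parent of $v$. The cluster of $v$ is $C_T(v)=\{x\in X: v\preceq x\}$. An edge-labeled tree $(T,\lambda)$ on $X$ with $M$ is a phylogenetic tree $T$ on $X$ with a map $\lambda\colon E(T)\to\mathcal{P}(M)$; an edge $e$ is an $m$-edge if $m\in\lambda(e)$. A map $\varepsilon\colon X^{\times}_{\mathrm{irr}}\to\mathcal{P}(M)$ is explained by $(T,\lambda)$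 if for all $(x,y)\in X^{\times}_{\mathrm{irr}}$ and $m\in M$: $m\in\varepsilon(x,y)$ iff there is an $m$-edge on the path from $\mathrm{lca}(x,y)$ to $y$; $\varepsilon$ is a Fitch map if some edge-labeled tree explains it. For $y\in X$, $m\in M$, the complementary neighborhood is $N_m[y]=\{x\in X\setminus\{y\}: m\notin\varepsilon(x,y)\}\cup\{y\}$. -}

module Defs where

open import Data.Nat using (ℕ; suc)
open import Data.Fin using (Fin)
open import Data.Fin.Subset using (Subset; _∈_; _∉_)
open import Data.Maybe using (Maybe; just; nothing)
open import Data.Product using (Σ; ∃; ∃-syntax; _×_; _,_)
open import Data.Sum using (_⊎_)
open import Relation.Nullary using (¬_)
open import Relation.Binary.PropositionalEquality using (_≡_; _≢_)
open import Function.Bundles using (_⇔_)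

-- A finite rooted tree: vertices Fin n, a parent map (nothing exactly at the
-- root) and a depth function strictly decreasing along parent edges
-- (this guarantees acyclicity / that every vertex reaches the root).
record RootedTree : Set where
  field
    n         : ℕ
    root      : Fin n
    par       : Fin n → Maybe (Fin n)
    par-root  : par root ≡ nothing
    par-none  : ∀ v → par v ≡ nothing → v ≡ root
    depth     : Fin n → ℕ
    depth-par : ∀ v w → par v ≡ just w → depth v ≡ suc (depth w)

open RootedTree public

Vertex : RootedTree → Set
Vertex T = Fin (n T)

ChildOf : (T : RootedTree) → Vertex T → Vertex T → Set
ChildOf T v w = par T v ≡ just w

IsLeaf : (T : RootedTree) → Vertex T → Set
IsLeaf T v = (v ≢ root T) × (∀ w → ¬ ChildOf T w v)

-- Phylogenetic tree on X = Fin nX: leaves are in bijection with X (via leaf);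
-- every non-leaf vertex has at least two children (root degree ≥ 2,
-- non-root inner vertices degree ≥ 3).
record PhyloTree (nX : ℕ) : Set where
  field
    tree        : RootedTree
    leaf        : Fin nX → Vertex tree
    leaf-inj    : ∀ x y → leaf x ≡ leaf y → x ≡ y
    leaf-isLeaf : ∀ x → IsLeaf tree (leaf x)
    leaf-onto   : ∀ v → IsLeaf tree v → ∃[ x ] leaf x ≡ v
    branching   : ∀ v → ¬ IsLeaf tree v →
                  ∃[ c₁ ] ∃[ c₂ ] (c₁ ≢ c₂ × ChildOf tree c₁ v × ChildOf tree c₂ v)

open PhyloTree public

-- ancestor relation v ⪯ w : v lies on the path from the root to w
data _⊢_⪯_ (T : RootedTree) : Vertex T → Vertex T → Set where
  ⪯-refl : ∀ {v} → T ⊢ v ⪯ v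
  ⪯-step : ∀ {v u w} → ChildOf T w u → T ⊢ v ⪯ u → T ⊢ v ⪯ w

_⊢_≺_ : (T : RootedTree) → Vertex T → Vertex T → Set
T ⊢ v ≺ w = (T ⊢ v ⪯ w) × (v ≢ w)

IsLCA : (T : RootedTree) → Vertex T → Vertex T → Vertex T → Set
IsLCA T a b w = (T ⊢ w ⪯ a) × (T ⊢ w ⪯ b) ×
                (∀ w' → T ⊢ w' ⪯ a → T ⊢ w' ⪯ b → T ⊢ w' ⪯ w)

-- Edges are identified with their lower endpoint u, i.e. the edge (par u , u).
-- The edge (par u , u) lies on the path between a and b.
EdgeOnPath : (T : RootedTree) → Vertex T → Vertex T → Vertex T → Set
EdgeOnPath T a b u = ∃[ w ] (IsLCA T a b w × (T ⊢ w ≺ u) × ((T ⊢ u ⪯ a) ⊎ (T ⊢ u ⪯ b)))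

EdgeOnPathLcaTo : (T : RootedTree) → Vertex T → Vertex T → Vertex T → Set
EdgeOnPathLcaTo T a b u = ∃[ w ] (IsLCA T a b w × (T ⊢ w ≺ u) × (T ⊢ u ⪯ b))

-- Edge labelling λ : E(T) → P(M), M = Fin k; the value at the root
-- (which has no parent edge) is irrelevant.
Labelling : (T : RootedTree) → ℕ → Set
Labelling T k = Vertex T → Subset k

-- A map ε : X×X → P(M); only its values at pairs x ≢ y are ever used.
EpsMap : ℕ → ℕ → Set
EpsMap nX k = Fin nX → Fin nX → Subset k

Explains : ∀ {nX k} → (P : PhyloTree nX) → Labelling (tree P) k → EpsMap nX k → Set
Explains {nX} {k} P lab ε =
  ∀ (x y : Fin nX) → x ≢ y → ∀ (m : Fin k) →
    (m ∈ ε x y) ⇔ (∃[ u ] (EdgeOnPathLcaTo (tree P) (leaf P x) (leaf P y) u × m ∈ lab u))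

IsFitch : ∀ {nX k} → EpsMap nX k → Set
IsFitch {nX} {k} ε = Σ (PhyloTree nX) λ P → Σ (Labelling (tree P) k) λ lab → Explains P lab ε

InN : ∀ {nX k} → EpsMap nX k → Fin nX → Fin k → Fin nX → Set
InN ε y m x = (x ≡ y) ⊎ ((x ≢ y) × (m ∉ ε x y))

InCluster : ∀ {nX} → (P : PhyloTree nX) → Vertex (tree P) → Fin nX → Set
InCluster P v x = tree P ⊢ v ⪯ leaf P x

Cond1 : ∀ {nX k} → (P : PhyloTree nX) → Labelling (tree P) k → Fin nX → Fin k → Vertex (tree P) → Set
Cond1 P lab y m v =
  (¬ (∃[ u ] (EdgeOnPath (tree P) v (leaf P y) u × m ∈ lab u))) ×
  (v ≢ root (tree P) → m ∈ lab v)

Cond2 : ∀ {nX k} → (P : PhyloTree nX) → EpsMap nX k → Fin nX → Fin k → Vertex (tree P) → Set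
Cond2 {nX} P ε y m v = ∀ (x : Fin nX) → InN ε y m x ⇔ InCluster P v x

-- Let v be the lower end of the lowest m-edge on the path from the root to y
-- (the root if there is none).  A leaf x ≠ y lies below v exactly when the path
-- from lca(x, y) to y carries no m-edge, i.e. when m ∉ ε(x, y); so N_m[y] = C(v).
-- Condition (1) holds for v and pins v down uniquely on the root–y path, and no
-- vertex off that path satisfies it, its own parent edge lying on its path to y.
-- Finally, because every inner vertex has two children, distinct vertices have
-- distinct clusters, so v is also the only vertex satisfying (2).
module Submission where

open import Defs
open import Data.Nat using (ℕ; zero; suc; _≤_; _<_; _+_; s≤s)
open import Data.Nat.Properties using (≤-refl; ≤-antisym; m≤n⇒m≤1+n; <⇒≢; <⇒≱; +-suc; +-identityʳ; m≤n+m)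
open import Data.Fin using (Fin; _≟_)
open import Data.Fin.Properties using (any?)
open import Data.Fin.Subset using (_∈_)
open import Data.Fin.Subset.Properties using (_∈?_)
open import Data.Maybe using (just; nothing)
open import Data.Maybe.Properties using (≡-dec)
open import Data.List using (allFin)
open import Data.List.Extrema.Nat using (argmax; f[xs]≤f[argmax])
open import Data.List.Membership.Propositional.Properties using (∈-allFin)
import Data.List.Relation.Unary.All as All
open import Data.Product using (_×_; ∃-syntax; _,_; proj₁; map₂)
open import Data.Sum using (_⊎_; inj₁; inj₂; [_,_]′)
open import Data.Empty using (⊥-elim)
open import Relation.Nullary using (¬_; Dec; yes; no)
open import Relation.Nullary.Decidable using (map′)
open import Relation.Unary using (Decidable)
open import Relation.Binary.PropositionalEquality using (_≡_; _≢_; refl; sym; trans; subst; cong)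
open import Function using (_∘_; id)
open import Function.Bundles using (_⇔_; mk⇔; Equivalence)

open Equivalence
import Function.Properties.Equivalence as Equiv

module Ancestry (T : RootedTree) where

  private
    V : Set
    V = Vertex T

  _⪯_ _≺_ : V → V → Set
  a ⪯ b = T ⊢ a ⪯ b
  a ≺ b = T ⊢ a ≺ b

  ⪯-trans : ∀ {a b c} → a ⪯ b → b ⪯ c → a ⪯ c
  ⪯-trans a⪯b ⪯-refl         = a⪯b
  ⪯-trans a⪯b (⪯-step e b⪯u) = ⪯-step e (⪯-trans a⪯b b⪯u)

  parent⪯ : ∀ {c v} → ChildOf T c v → v ⪯ c
  parent⪯ e = ⪯-step e ⪯-refl

  ⪯⇒depth≤ : ∀ {a b} → a ⪯ b → depth T a ≤ depth T b
  ⪯⇒depth≤ ⪯-refl = ≤-refl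
  ⪯⇒depth≤ {b = b} (⪯-step {u = u} e a⪯u)
    rewrite depth-par T b u e = m≤n⇒m≤1+n (⪯⇒depth≤ a⪯u)

  ⪯∧depth≡⇒≡ : ∀ {a b} → a ⪯ b → depth T a ≡ depth T b → a ≡ b
  ⪯∧depth≡⇒≡ ⪯-refl _ = refl
  ⪯∧depth≡⇒≡ {a} {b} (⪯-step {u = u} e a⪯u) d≡ =
    ⊥-elim (<⇒≢ (subst (depth T a <_) (sym (depth-par T b u e)) (s≤s (⪯⇒depth≤ a⪯u))) d≡)

  ⪯-antisym : ∀ {a b} → a ⪯ b → b ⪯ a → a ≡ b
  ⪯-antisym a⪯b b⪯a = ⪯∧depth≡⇒≡ a⪯b (≤-antisym (⪯⇒depth≤ a⪯b) (⪯⇒depth≤ b⪯a))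

  ≺⇒⋡ : ∀ {a b} → a ≺ b → ¬ b ⪯ a
  ≺⇒⋡ (a⪯b , a≢b) b⪯a = a≢b (⪯-antisym a⪯b b⪯a)

  ⪯-≺-trans : ∀ {a b c} → a ⪯ b → b ≺ c → a ≺ c
  ⪯-≺-trans a⪯b (b⪯c , b≢c) = ⪯-trans a⪯b b⪯c , λ { refl → b≢c (⪯-antisym b⪯c a⪯b) }

  ⪯-comparable : ∀ {a b z} → a ⪯ z → b ⪯ z → (a ⪯ b) ⊎ (b ⪯ a)
  ⪯-comparable ⪯-refl         b⪯z             = inj₂ b⪯z
  ⪯-comparable (⪯-step e a⪯u) ⪯-refl          = inj₁ (⪯-step e a⪯u)
  ⪯-comparable (⪯-step e a⪯u) (⪯-step e′ b⪯u′) with trans (sym e) e′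
  ... | refl = ⪯-comparable a⪯u b⪯u′

  ≺⇒⪯-parent : ∀ {a u p} → a ≺ u → ChildOf T u p → a ⪯ p
  ≺⇒⪯-parent (⪯-refl , a≢a) _ = ⊥-elim (a≢a refl)
  ≺⇒⪯-parent (⪯-step e a⪯u , _) e′ with trans (sym e) e′
  ... | refl = a⪯u

  root⪯ : ∀ v → root T ⪯ v
  root⪯ v = climb _ v ≤-refl
    where
    climb : ∀ d v → depth T v < d → root T ⪯ v
    climb (suc d) v (s≤s dv≤d) with par T v in e
    ... | nothing = subst (root T ⪯_) (sym (par-none T v e)) ⪯-refl
    ... | just p  = ⪯-step e (climb d p (subst (_≤ d) (depth-par T v p e) dv≤d))

  ≺⇒≢root : ∀ {a b} → a ≺ b → b ≢ root T
  ≺⇒≢root a≺b refl = ≺⇒⋡ a≺b (root⪯ _)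

  _⪯?_ : ∀ a b → Dec (a ⪯ b)
  a ⪯? b = descend (root⪯ b)
    where
    descend : ∀ {u} → root T ⪯ u → Dec (a ⪯ u)
    descend {u} r⪯u with a ≟ u
    ... | yes refl = yes ⪯-refl
    descend ⪯-refl         | no a≢r = no (λ a⪯r → a≢r (⪯-antisym a⪯r (root⪯ a)))
    descend (⪯-step e r⪯p) | no a≢u =
      map′ (⪯-step e) (λ a⪯u → ≺⇒⪯-parent (a⪯u , a≢u) e) (descend r⪯p)

  lca : ∀ a b → ∃[ l ] IsLCA T a b l
  lca a b = descend (root⪯ b)
    where
    descend : ∀ {u} → root T ⪯ u → ∃[ l ] IsLCA T a u l
    descend {u} r⪯u with u ⪯? a
    ... | yes u⪯a = u , u⪯a , ⪯-refl , λ _ _ w⪯u → w⪯u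
    descend ⪯-refl         | no r⋠a = ⊥-elim (r⋠a (root⪯ a))
    descend (⪯-step e r⪯p) | no u⋠a with descend r⪯p
    ... | l , l⪯a , l⪯p , greatest = l , l⪯a , ⪯-step e l⪯p , λ w w⪯a w⪯u →
      greatest w w⪯a (≺⇒⪯-parent (w⪯u , λ { refl → u⋠a w⪯a }) e)

  ancestor-isLCA : ∀ {a b} → a ⪯ b → IsLCA T a b a
  ancestor-isLCA a⪯b = ⪯-refl , a⪯b , λ _ w⪯a _ → w⪯a

  edgeOnPath-from-ancestor : ∀ {v b u} → v ⪯ b → EdgeOnPath T v b u → v ≺ u × u ⪯ b
  edgeOnPath-from-ancestor {v} v⪯b (l , (_ , _ , greatest) , l≺u , side) =
    v≺u , [ (λ u⪯v → ⊥-elim (≺⇒⋡ v≺u u⪯v)) , id ]′ side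
    where
    v≺u = ⪯-≺-trans (greatest v ⪯-refl v⪯b) l≺u

  edgeOnPath-below-ancestor : ∀ {v b u} → v ≺ u → u ⪯ b → EdgeOnPath T v b u
  edgeOnPath-below-ancestor v≺u u⪯b =
    _ , ancestor-isLCA (⪯-trans (proj₁ v≺u) u⪯b) , v≺u , inj₂ u⪯b

  edgeOnPath-self : ∀ {v b} → ¬ v ⪯ b → EdgeOnPath T v b v
  edgeOnPath-self {v} {b} v⋠b with lca v b
  ... | l , isLCA@(l⪯v , l⪯b , _) = l , isLCA , (l⪯v , λ { refl → v⋠b l⪯b }) , inj₁ ⪯-refl

  HasMarkedEdge : (V → Set) → (V → Set) → Set
  HasMarkedEdge Q OnPath = ∃[ u ] (OnPath u × Q u)

  record LowestMarkedAncestor (Q : V → Set) (y : V) : Set where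
    field
      anc            : V
      anc⪯           : anc ⪯ y
      anc-marked     : anc ≢ root T → Q anc
      unmarked-below : ∀ {u} → anc ≺ u → u ⪯ y → ¬ Q u

  lowestMarkedAncestor : ∀ {Q} → Decidable Q → ∀ y → LowestMarkedAncestor Q y
  lowestMarkedAncestor {Q} Q? y = descend (root⪯ y)
    where
    descend : ∀ {u} → root T ⪯ u → LowestMarkedAncestor Q u
    descend ⪯-refl = record
      { anc = root T ; anc⪯ = ⪯-refl ; anc-marked = λ r≢r → ⊥-elim (r≢r refl)
      ; unmarked-below = λ r≺u u⪯r → ⊥-elim (≺⇒⋡ r≺u u⪯r) }
    descend {u} (⪯-step e r⪯p) with Q? u
    ... | yes Qu = record
      { anc = u ; anc⪯ = ⪯-refl ; anc-marked = λ _ → Qu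
      ; unmarked-below = λ u≺v v⪯u → ⊥-elim (≺⇒⋡ u≺v v⪯u) }
    ... | no ¬Qu = record
      { anc = anc ; anc⪯ = ⪯-step e anc⪯ ; anc-marked = anc-marked
      ; unmarked-below = unmarked-below′ }
      where
      open LowestMarkedAncestor (descend r⪯p)
      unmarked-below′ : ∀ {v} → anc ≺ v → v ⪯ u → ¬ Q v
      unmarked-below′ {v} a≺v v⪯u with v ≟ u
      ... | yes refl = ¬Qu
      ... | no v≢u   = unmarked-below a≺v (≺⇒⪯-parent (v⪯u , v≢u) e)

  module _ {Q : V → Set} {y : V} (L : LowestMarkedAncestor Q y) where
    open LowestMarkedAncestor L

    no-marked-edge-below-anc : ¬ HasMarkedEdge Q (EdgeOnPath T anc y)
    no-marked-edge-below-anc (u , onPath , Qu) =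
      let anc≺u , u⪯y = edgeOnPath-from-ancestor anc⪯ onPath in unmarked-below anc≺u u⪯y Qu

    anc-unique : ∀ v → ¬ HasMarkedEdge Q (EdgeOnPath T v y) → (v ≢ root T → Q v) → v ≡ anc
    anc-unique v unmarked marked with v ⪯? y
    ... | no v⋠y = ⊥-elim (unmarked (v , edgeOnPath-self v⋠y , marked λ { refl → v⋠y (root⪯ y) }))
    ... | yes v⪯y with v ≟ anc | ⪯-comparable v⪯y anc⪯
    ...   | yes v≡a | _        = v≡a
    ...   | no v≢a  | inj₁ v⪯a =
      ⊥-elim (unmarked (anc , edgeOnPath-below-ancestor (v⪯a , v≢a) anc⪯ , anc-marked (≺⇒≢root (v⪯a , v≢a))))
    ...   | no v≢a  | inj₂ a⪯v =
      ⊥-elim (unmarked-below a≺v v⪯y (marked (≺⇒≢root a≺v)))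
      where a≺v = a⪯v , v≢a ∘ sym

    anc⪯⇔no-marked-edge-from-lca : ∀ a → anc ⪯ a ⇔ (¬ HasMarkedEdge Q (EdgeOnPathLcaTo T a y))
    anc⪯⇔no-marked-edge-from-lca a = mk⇔ unmarked anc⪯a
      where
      unmarked : anc ⪯ a → ¬ HasMarkedEdge Q (EdgeOnPathLcaTo T a y)
      unmarked anc⪯a (u , (l , (_ , _ , greatest) , l≺u , u⪯y) , Qu) =
        unmarked-below (⪯-≺-trans (greatest anc anc⪯a anc⪯) l≺u) u⪯y Qu
      anc⪯a : ¬ HasMarkedEdge Q (EdgeOnPathLcaTo T a y) → anc ⪯ a
      anc⪯a no-edge with lca a y
      ... | l , isLCA@(l⪯a , l⪯y , _) with ⪯-comparable anc⪯ l⪯y | l ≟ anc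
      ...   | inj₁ anc⪯l | _        = ⪯-trans anc⪯l l⪯a
      ...   | inj₂ _     | yes refl = l⪯a
      ...   | inj₂ l⪯anc | no l≢anc =
        ⊥-elim (no-edge (anc , (l , isLCA , l≺anc , anc⪯) , anc-marked (≺⇒≢root l≺anc)))
        where l≺anc = l⪯anc , l≢anc

module Phylogeny {nX} (P : PhyloTree nX) where

  open Ancestry (tree P)

  private
    T = tree P

  childless⇒leaf : ∀ {v} → (∀ c → ¬ ChildOf T c v) → ∃[ x ] leaf P x ≡ v
  childless⇒leaf {v} childless with v ≟ root T
  ... | no v≢r    = leaf-onto P v (v≢r , childless)
  ... | yes refl with branching P (root T) (λ (r≢r , _) → r≢r refl)
  ...   | c , _ , _ , c→r , _ = ⊥-elim (childless c c→r)

  leaf-below : ∀ v → ∃[ x ] v ⪯ leaf P x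
  leaf-below v = descend (suc maxDepth) v (m≤n+m (suc maxDepth) (depth T v))
    where
    maxDepth : ℕ
    maxDepth = depth T (argmax (depth T) (root T) (allFin (n T)))
    depth≤max : ∀ u → depth T u ≤ maxDepth
    depth≤max u = All.lookup (f[xs]≤f[argmax] (root T) (allFin (n T))) (∈-allFin u)
    descend : ∀ d u → maxDepth < depth T u + d → ∃[ x ] u ⪯ leaf P x
    descend zero u deep = ⊥-elim (<⇒≱ deep (subst (_≤ maxDepth) (sym (+-identityʳ _)) (depth≤max u)))
    descend (suc d) u deep with any? (λ c → ≡-dec _≟_ (par T c) (just u))
    ... | yes (c , c→u) = map₂ (⪯-trans (parent⪯ c→u)) (descend d c deeper)
      where
      deeper = subst (maxDepth <_) (trans (+-suc _ d) (cong (_+ d) (sym (depth-par T c u c→u)))) deep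
    ... | no childless = map₂ (λ { refl → ⪯-refl }) (childless⇒leaf (λ c c→u → childless (c , c→u)))

  another-child : ∀ {c v} → ChildOf T c v → ∃[ c′ ] (c′ ≢ c × ChildOf T c′ v)
  another-child {c} {v} c→v with branching P v (λ (_ , childless) → childless c c→v)
  ... | c₁ , c₂ , c₁≢c₂ , c₁→v , c₂→v with c₁ ≟ c
  ...   | yes refl = c₂ , c₁≢c₂ ∘ sym , c₂→v
  ...   | no c₁≢c  = c₁ , c₁≢c , c₁→v

  siblings-below-common≡ : ∀ {c c′ v z} → ChildOf T c v → ChildOf T c′ v → c ⪯ z → c′ ⪯ z → c ≡ c′
  siblings-below-common≡ {c} {c′} {v} c→v c′→v c⪯z c′⪯z with ⪯-comparable c⪯z c′⪯z
  ... | inj₁ c⪯c′ = ⪯∧depth≡⇒≡ c⪯c′ (trans (depth-par T c v c→v) (sym (depth-par T c′ v c′→v)))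
  ... | inj₂ c′⪯c = sym (⪯∧depth≡⇒≡ c′⪯c (trans (depth-par T c′ v c′→v) (sym (depth-par T c v c→v))))

  child-towards : ∀ {v w} → v ⪯ w → v ≢ w → ∃[ c ] (ChildOf T c v × c ⪯ w)
  child-towards ⪯-refl v≢v = ⊥-elim (v≢v refl)
  child-towards {v} (⪯-step {u = p} w→p v⪯p) _ with v ≟ p
  ... | yes refl = _ , w→p , ⪯-refl
  ... | no v≢p   = map₂ (map₂ (λ c⪯p → ⪯-trans c⪯p (parent⪯ w→p))) (child-towards v⪯p v≢p)

  -- A second child of v carries a leaf of C(v) that lies outside C(w).
  cluster⊆⇒≡ : ∀ {v w} → v ⪯ w → (∀ x → v ⪯ leaf P x → w ⪯ leaf P x) → v ≡ w
  cluster⊆⇒≡ {v} {w} v⪯w C[v]⊆C[w] with v ≟ w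
  ... | yes v≡w = v≡w
  ... | no v≢w with child-towards v⪯w v≢w
  ... | c , c→v , c⪯w with another-child c→v
  ... | c′ , c′≢c , c′→v with leaf-below c′
  ... | x , c′⪯x with ⪯-comparable (C[v]⊆C[w] x (⪯-trans (parent⪯ c′→v) c′⪯x)) c′⪯x
  ... | inj₁ w⪯c′ = ⊥-elim (c′≢c (siblings-below-common≡ c′→v c→v ⪯-refl (⪯-trans c⪯w w⪯c′)))
  ... | inj₂ c′⪯w = ⊥-elim (c′≢c (siblings-below-common≡ c′→v c→v c′⪯w c⪯w))

  cluster-injective : ∀ {v w} → (∀ x → InCluster P v x ⇔ InCluster P w x) → v ≡ w
  cluster-injective {v} {w} C[v]≡C[w] with leaf-below v
  ... | x , v⪯x with ⪯-comparable v⪯x (to (C[v]≡C[w] x) v⪯x)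
  ... | inj₁ v⪯w = cluster⊆⇒≡ v⪯w (to ∘ C[v]≡C[w])
  ... | inj₂ w⪯v = sym (cluster⊆⇒≡ w⪯v (from ∘ C[v]≡C[w]))

module Explanation {nX k} (P : PhyloTree nX) (lab : Labelling (tree P) k) {ε : EpsMap nX k}
                   (explains : Explains P lab ε) (y : Fin nX) (m : Fin k) where

  open Ancestry (tree P)
  open Phylogeny P

  lowest : LowestMarkedAncestor (λ u → m ∈ lab u) (leaf P y)
  lowest = lowestMarkedAncestor (λ u → m ∈? lab u) (leaf P y)

  open LowestMarkedAncestor lowest public

  cond1-anc : Cond1 P lab y m anc
  cond1-anc = no-marked-edge-below-anc lowest , anc-marked

  cond2-anc : Cond2 P ε y m anc
  cond2-anc x with x ≟ y
  ... | yes refl = mk⇔ (λ _ → anc⪯) (λ _ → inj₁ refl)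
  ... | no x≢y   = mk⇔ N⊆C C⊆N
    where
    m∈ε⇔ = explains x y x≢y m
    anc⪯x⇔ = anc⪯⇔no-marked-edge-from-lca lowest (leaf P x)
    N⊆C : InN ε y m x → InCluster P anc x
    N⊆C (inj₁ x≡y)      = ⊥-elim (x≢y x≡y)
    N⊆C (inj₂ (_ , m∉)) = from anc⪯x⇔ (m∉ ∘ from m∈ε⇔)
    C⊆N : InCluster P anc x → InN ε y m x
    C⊆N anc⪯x = inj₂ (x≢y , to anc⪯x⇔ anc⪯x ∘ to m∈ε⇔)

  cond1⇒anc : ∀ v → Cond1 P lab y m v → v ≡ anc
  cond1⇒anc v (unmarked , marked) = anc-unique lowest v unmarked marked

  cond2⇒anc : ∀ v → Cond2 P ε y m v → v ≡ anc
  cond2⇒anc v N≡C[v] = cluster-injective (λ x → Equiv.trans (Equiv.sym (N≡C[v] x)) (cond2-anc x))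

proposition1 : ∀ {nX k : ℕ} (ε : EpsMap nX k) → IsFitch ε →
    (P : PhyloTree nX) (lab : Labelling (tree P) k) → Explains P lab ε →
    ∀ (y : Fin nX) (m : Fin k) →
      (∃[ v ] (Cond1 P lab y m v × Cond2 P ε y m v)) ×
      (∀ v → Cond1 P lab y m v ⇔ Cond2 P ε y m v)
proposition1 ε _ P lab explains y m =
  (anc , cond1-anc , cond2-anc) ,
  λ v → mk⇔ (λ c₁ → subst (Cond2 P ε y m) (sym (cond1⇒anc v c₁)) cond2-anc)
            (λ c₂ → subst (Cond1 P lab y m) (sym (cond2⇒anc v c₂)) cond1-anc)
  where
  open Explanation P lab explains y m
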